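{- Define the "natural representation" $s(x)$ of a rational number $x$, a finite sequence of integers written $[s_0;s_1,\dots,s_k]$, recursively as follows. If $x$ is an integer, $s(x)=[x]$ (a sequence of length one). Otherwise, put $\varphi=x-\lfloor x\rfloor\in(0,1)$; if $\varphi<\tfrac12$, let $s(x)$ be $\lceil x\rceil$ followed by the negatives of the entries of $s\!\left(\tfrac{1}{\varphi}-2\right)$; if $\varphi\ge\tfrac12$, let $s(x)$ be $\lceil x\rceil$ followed by the entries of $s\!\left(\tfrac{1}{1-\varphi}-2\right)$. Define, for a finite integer sequence $(s_0,s_1,\dots,s_k)$, $k\ge 0$, $$F(s_0,\dots,s_k)=\begin{cases} s_0 & k=0,\\ s_0-\dfrac{1}{2+F(s_1,\dots,s_k)} & k\ge1,\ s_1\ge 0,\\ s_0-1+\dfrac{1}{2+F(-s_1,\dots,-s_k)} & k\ge1,\ s_1<0.\end{cases}$$ Let $\mathcal S$ be the set of all finite sequences of integers $(a_0,a_1,\dots,a_n)$, $n\ge 0$, such that $a_i\neq 0$ for every $1\le i\le n-1$ (the first and last entries may be zero). Then for every rational $x$ the recursion defining $s(x)$ terminates, $s$ is a bijection from $\mathbb Q$ onto $\mathcal S$, $F$ is well defined on $\mathcal S$, and $F(s(x))=x$ for every $x\in\mathbb Q$ (so $F|_{\mathcal S}$ is the inverse of $s$).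
   Context: $\lfloor x\rfloor$ denotes the largest integer not exceeding $x$ and $\lceil x\rceil$ the smallest integer not less than $x$. -}

module Defs where

open import Data.Integer as ℤ using (ℤ; +_; 0ℤ)
open import Data.Rational using (ℚ; _/_; _-_; _+_; _<_; 1/_; ½; 1ℚ; NonZero; floor; ceiling)
open import Data.List using (List; []; _∷_; map; length; lookup)
open import Data.Fin using (Fin; toℕ)
open import Data.Nat as ℕ using (ℕ; suc)
open import Data.Product using (∃; _×_)
open import Relation.Binary.PropositionalEquality using (_≡_; _≢_)
open import Relation.Nullary using (¬_)

ι : ℤ → ℚ
ι z = z / 1

2ℚ : ℚ
2ℚ = + 2 / 1

IsInteger : ℚ → Set
IsInteger x = ∃ λ (z : ℤ) → x ≡ ι z

frac : ℚ → ℚ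
frac x = x - ι (floor x)

-- Rep x l : "the recursion defining s(x) terminates with s(x) = l"
-- (the graph of the recursive definition of the natural representation)
data Rep : ℚ → List ℤ → Set where
  rep-int : (z : ℤ) → Rep (ι z) (z ∷ [])
  rep-lt  : (x : ℚ) (l : List ℤ) → ¬ IsInteger x → (nz : NonZero (frac x)) →
            frac x < ½ →
            Rep ((1/ frac x) {{nz}} - 2ℚ) l →
            Rep x (ceiling x ∷ map ℤ.-_ l)
  rep-ge  : (x : ℚ) (l : List ℤ) → ¬ IsInteger x → (nz : NonZero (1ℚ - frac x)) →
            ¬ (frac x < ½) →
            Rep ((1/ (1ℚ - frac x)) {{nz}} - 2ℚ) l →
            Rep x (ceiling x ∷ l)

-- FRel l v : "F(l) is defined and equals v" (the graph of the recursive F;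
-- a step is only defined when the denominator 2 + F(...) is nonzero)
data FRel : List ℤ → ℚ → Set where
  F-one : (s₀ : ℤ) → FRel (s₀ ∷ []) (ι s₀)
  F-pos : (s₀ s₁ : ℤ) (rest : List ℤ) (v : ℚ) → ℤ._≤_ 0ℤ s₁ →
          FRel (s₁ ∷ rest) v → (nz : NonZero (2ℚ + v)) →
          FRel (s₀ ∷ s₁ ∷ rest) (ι s₀ - (1/ (2ℚ + v)) {{nz}})
  F-neg : (s₀ s₁ : ℤ) (rest : List ℤ) (v : ℚ) → ℤ._<_ s₁ 0ℤ →
          FRel (map ℤ.-_ (s₁ ∷ rest)) v → (nz : NonZero (2ℚ + v)) →
          FRel (s₀ ∷ s₁ ∷ rest) ((ι s₀ - 1ℚ) + (1/ (2ℚ + v)) {{nz}})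

InS : List ℤ → Set
InS l = (0 ℕ.< length l) ×
        ((i : Fin (length l)) → 1 ℕ.≤ toℕ i → suc (toℕ i) ℕ.< length l → lookup l i ≢ 0ℤ)

module Submission where

-- After the basic
-- arithmetic of the embedding ι : ℤ → ℚ and of floor, ceiling and the
-- fractional part, everything rests on three observations.
--  * Termination: if x = n/d is not an integer and r = n mod d, then
--    φ·d = r and (1-φ)·d = d-r; hence the next argument y = 1/q - 2
--    (q = φ or 1-φ) satisfies y·k = d - 2k for some 0 < k < d, so the
--    denominator of y is smaller than that of x.  Induction on the
--    denominator gives s(x) for every x.
--  * Signs: the head of s(y) is y itself or ⌈y⌉, so it is positive exactly
--    when y is, and for y ≥ 0 it is nonnegative (nonzero unless s(y) is a
--    singleton).  In the branch φ < ½ the next argument is positive, in the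
--    branch φ ≥ ½ nonnegative.  This shows s(x) ∈ 𝒮, and that the sign
--    of s₁ selects the matching clause of F, whence F(s(x)) = x.
--  * Surjectivity: the recursion can be run backwards: given s(y) with a
--    head of suitable sign and any h, the rational (h-1) + u or
--    (h-1) + (1-u), u = 1/(2+y), has representation h followed by s(y).
-- Uniqueness of s and of F is by induction on their graphs, and injectivity
-- of s follows from F ∘ s = id.

open import Defs
open import Data.Integer as ℤ using (ℤ; +_; 0ℤ)
import Data.Integer.Properties as ℤP
import Data.Integer.DivMod as ℤDM
import Data.Integer.Solver as ℤSolver
open import Data.Rational as ℚ
  using (ℚ; mkℚ; _+_; _-_; _*_; -_; _<_; _≤_; 1/_; ½; 0ℚ; 1ℚ; NonZero; Positive; floor; ceiling; ↥_; ↧_; ↧ₙ_)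
import Data.Rational.Properties as ℚP
import Data.Rational.Unnormalised as ℚᵘ
import Data.Rational.Unnormalised.Properties as ℚᵘP
import Data.Rational.Solver as ℚSolver
open import Data.Nat as ℕ using (ℕ; zero; suc)
import Data.Nat.Properties as ℕP
import Data.Nat.Coprimality as Coprimality
open import Data.Nat.Divisibility using (_∣_; divides; ∣⇒≤)
open import Data.List using (List; []; _∷_; map; length; lookup)
open import Data.Fin using (Fin; toℕ) renaming (zero to fzero; suc to fsuc)
open import Data.Product using (∃; _×_; _,_)
open import Data.Sum using (_⊎_; inj₁; inj₂)
open import Data.Unit using (⊤; tt)
open import Data.Empty using (⊥; ⊥-elim)
open import Relation.Nullary using (¬_; Dec; yes; no)
open import Relation.Binary.Definitions using (tri<; tri≈; tri>)
open import Relation.Binary.PropositionalEquality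

ι-canonical : ∀ z → ι z ≡ mkℚ z 0 (Coprimality.sym (Coprimality.1-coprimeTo ℤ.∣ z ∣))
ι-canonical z = ℚP.↥p/↧p≡p (mkℚ z 0 _)

ι-injective : ∀ {a b} → ι a ≡ ι b → a ≡ b
ι-injective {a} {b} e = subst₂ _≡_ (cong ↥_ (ι-canonical a)) (cong ↥_ (ι-canonical b)) (cong ↥_ e)

toℚᵘ-ι : ∀ z → ℚ.toℚᵘ (ι z) ≡ ℚᵘ.mkℚᵘ z 0
toℚᵘ-ι z = cong ℚ.toℚᵘ (ι-canonical z)

ι-+ : ∀ a b → ι (a ℤ.+ b) ≡ ι a + ι b
ι-+ a b = ℚP.toℚᵘ-injective (begin
  ℚ.toℚᵘ (ι (a ℤ.+ b))            ≡⟨ toℚᵘ-ι (a ℤ.+ b) ⟩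
  ℚᵘ.mkℚᵘ (a ℤ.+ b) 0             ≈⟨ ℚᵘ.*≡* (solve 2 (λ a b → (a :+ b) :* con (+ 1) := (a :* con (+ 1) :+ b :* con (+ 1)) :* con (+ 1)) refl a b) ⟩
  ℚᵘ.mkℚᵘ a 0 ℚᵘ.+ ℚᵘ.mkℚᵘ b 0    ≡⟨ sym (cong₂ ℚᵘ._+_ (toℚᵘ-ι a) (toℚᵘ-ι b)) ⟩
  ℚ.toℚᵘ (ι a) ℚᵘ.+ ℚ.toℚᵘ (ι b)  ≈⟨ ℚᵘP.≃-sym (ℚP.toℚᵘ-homo-+ (ι a) (ι b)) ⟩
  ℚ.toℚᵘ (ι a + ι b)              ∎)
  where
  open ℚᵘP.≃-Reasoning
  open ℤSolver.+-*-Solver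

ι-* : ∀ a b → ι (a ℤ.* b) ≡ ι a * ι b
ι-* a b = ℚP.toℚᵘ-injective (begin
  ℚ.toℚᵘ (ι (a ℤ.* b))            ≡⟨ toℚᵘ-ι (a ℤ.* b) ⟩
  ℚᵘ.mkℚᵘ (a ℤ.* b) 0             ≡⟨ sym (cong₂ ℚᵘ._*_ (toℚᵘ-ι a) (toℚᵘ-ι b)) ⟩
  ℚ.toℚᵘ (ι a) ℚᵘ.* ℚ.toℚᵘ (ι b)  ≈⟨ ℚᵘP.≃-sym (ℚP.toℚᵘ-homo-* (ι a) (ι b)) ⟩
  ℚ.toℚᵘ (ι a * ι b)              ∎)
  where open ℚᵘP.≃-Reasoning

ι-neg : ∀ a → ι (ℤ.- a) ≡ - ι a
ι-neg a = ℚP.toℚᵘ-injective (begin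
  ℚ.toℚᵘ (ι (ℤ.- a))   ≡⟨ toℚᵘ-ι (ℤ.- a) ⟩
  ℚᵘ.mkℚᵘ (ℤ.- a) 0    ≡⟨ sym (cong ℚᵘ.-_ (toℚᵘ-ι a)) ⟩
  ℚᵘ.- ℚ.toℚᵘ (ι a)    ≈⟨ ℚᵘP.≃-sym (ℚP.toℚᵘ-homo‿- (ι a)) ⟩
  ℚ.toℚᵘ (- ι a)       ∎)
  where open ℚᵘP.≃-Reasoning

ι-- : ∀ a b → ι (a ℤ.- b) ≡ ι a - ι b
ι-- a b = trans (ι-+ a (ℤ.- b)) (cong (λ w → ι a + w) (ι-neg b))

ι-suc : ∀ z → ι (ℤ.suc z) ≡ ι z + 1ℚ
ι-suc z = trans (ι-+ (+ 1) z) (ℚP.+-comm 1ℚ (ι z))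

ι-<-mono : ∀ {a b} → a ℤ.< b → ι a < ι b
ι-<-mono {a} {b} a<b rewrite ι-canonical a | ι-canonical b =
  ℚ.*<* (subst₂ ℤ._<_ (sym (ℤP.*-identityʳ a)) (sym (ℤP.*-identityʳ b)) a<b)

ι-≤-mono : ∀ {a b} → a ℤ.≤ b → ι a ≤ ι b
ι-≤-mono {a} {b} a≤b rewrite ι-canonical a | ι-canonical b =
  ℚ.*≤* (subst₂ ℤ._≤_ (sym (ℤP.*-identityʳ a)) (sym (ℤP.*-identityʳ b)) a≤b)

ι-<-cancel : ∀ {a b} → ι a < ι b → a ℤ.< b
ι-<-cancel {a} {b} ιa<ιb rewrite ι-canonical a | ι-canonical b with ιa<ιb
... | ℚ.*<* a<b = subst₂ ℤ._<_ (ℤP.*-identityʳ a) (ℤP.*-identityʳ b) a<b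

ι-≤-cancel : ∀ {a b} → ι a ≤ ι b → a ℤ.≤ b
ι-≤-cancel {a} {b} ιa≤ιb rewrite ι-canonical a | ι-canonical b with ιa≤ιb
... | ℚ.*≤* a≤b = subst₂ ℤ._≤_ (ℤP.*-identityʳ a) (ℤP.*-identityʳ b) a≤b

ι-positive : ∀ n → Positive (ι (+ suc n))
ι-positive n = ℚ.positive (ι-<-mono {0ℤ} {+ suc n} (ℤ.+<+ (ℕ.s≤s ℕ.z≤n)))

≤∧≢⇒pos : ∀ {p} → 0ℚ ≤ p → p ≢ 0ℚ → 0ℚ < p
≤∧≢⇒pos {p} 0≤p p≢0 with ℚP.<-cmp 0ℚ p
... | tri< 0<p _ _ = 0<p
... | tri≈ _ 0≡p _ = ⊥-elim (p≢0 (sym 0≡p))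
... | tri> _ _ p<0 = ⊥-elim (ℚP.<-irrefl refl (ℚP.<-≤-trans p<0 0≤p))

p<q⇒0<q-p : ∀ {p q} → p < q → 0ℚ < q - p
p<q⇒0<q-p {p} {q} p<q = subst (_< q - p) (ℚP.+-inverseʳ p) (ℚP.+-monoˡ-< (- p) p<q)

p≤q⇒0≤q-p : ∀ {p q} → p ≤ q → 0ℚ ≤ q - p
p≤q⇒0≤q-p {p} {q} p≤q = subst (_≤ q - p) (ℚP.+-inverseʳ p) (ℚP.+-monoˡ-≤ (- p) p≤q)

-- Taking reciprocals reverses the order of positive rationals: multiply by
-- c = 1/p · 1/q ≥ 0, noting c·p = 1/q and c·q = 1/p.
module _ (p q : ℚ) .{{_ : Positive p}} .{{_ : Positive q}} where
  private
    instance
      p≢0 : NonZero p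
      p≢0 = ℚP.pos⇒nonZero p
      q≢0 : NonZero q
      q≢0 = ℚP.pos⇒nonZero q
      c>0 : Positive (1/ p * 1/ q)
      c>0 = ℚP.pos*pos⇒pos (1/ p) {{ℚP.1/pos⇒pos p}} (1/ q) {{ℚP.1/pos⇒pos q}}
      c≥0 : ℚ.NonNegative (1/ p * 1/ q)
      c≥0 = ℚP.pos⇒nonNeg (1/ p * 1/ q)
    open ℚSolver.+-*-Solver
    c·p≡1/q : (1/ p * 1/ q) * p ≡ 1/ q
    c·p≡1/q = trans (solve 3 (λ a b p → (a :* b) :* p := (a :* p) :* b) refl (1/ p) (1/ q) p)
                (trans (cong (_* 1/ q) (ℚP.*-inverseˡ p)) (ℚP.*-identityˡ (1/ q)))
    c·q≡1/p : (1/ p * 1/ q) * q ≡ 1/ p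
    c·q≡1/p = trans (solve 3 (λ a b q → (a :* b) :* q := (b :* q) :* a) refl (1/ p) (1/ q) q)
                (trans (cong (_* 1/ p) (ℚP.*-inverseˡ q)) (ℚP.*-identityˡ (1/ p)))

  1/-antimono-≤ : p ≤ q → 1/ q ≤ 1/ p
  1/-antimono-≤ p≤q = subst₂ _≤_ c·p≡1/q c·q≡1/p (ℚP.*-monoˡ-≤-nonNeg (1/ p * 1/ q) p≤q)

  1/-antimono-< : p < q → 1/ q < 1/ p
  1/-antimono-< p<q = subst₂ _<_ c·p≡1/q c·q≡1/p (ℚP.*-monoʳ-<-pos (1/ p * 1/ q) p<q)

<-suc⇒≤ : ∀ {a b} → a ℤ.< ℤ.suc b → a ℤ.≤ b
<-suc⇒≤ {a} {b} a<1+b = subst (a ℤ.≤_) (ℤP.pred-suc b) (ℤP.i<j⇒i≤pred[j] a<1+b)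

≤⇒<-suc : ∀ {a b} → a ℤ.≤ b → a ℤ.< ℤ.suc b
≤⇒<-suc {a} {b} a≤b = ℤP.i≤pred[j]⇒i<j (subst (a ℤ.≤_) (sym (ℤP.pred-suc b)) a≤b)

rem : ℚ → ℕ
rem x = ↥ x ℤDM.% ↧ x

numerator-division : ∀ x → ↥ x ≡ + rem x ℤ.+ floor x ℤ.* ↧ x
numerator-division (mkℚ n d-1 _) = ℤDM.a≡a%n+[a/n]*n n (+ suc d-1)

rem<denominator : ∀ x → rem x ℕ.< ↧ₙ x
rem<denominator (mkℚ n d-1 _) = ℤDM.n%d<d n (+ suc d-1)

times-denominator : ∀ x → x * ι (↧ x) ≡ ι (↥ x)
times-denominator x@(mkℚ n d-1 _) = ℚP.toℚᵘ-injective (begin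
  ℚ.toℚᵘ (x * ι d)                 ≈⟨ ℚP.toℚᵘ-homo-* x (ι d) ⟩
  ℚᵘ.mkℚᵘ n d-1 ℚᵘ.* ℚ.toℚᵘ (ι d)  ≡⟨ cong (ℚᵘ.mkℚᵘ n d-1 ℚᵘ.*_) (toℚᵘ-ι d) ⟩
  ℚᵘ.mkℚᵘ n d-1 ℚᵘ.* ℚᵘ.mkℚᵘ d 0   ≈⟨ ℚᵘ.*≡* n·d≡n·d ⟩
  ℚᵘ.mkℚᵘ n 0                      ≡⟨ sym (toℚᵘ-ι n) ⟩
  ℚ.toℚᵘ (ι n)                     ∎)
  where
  open ℚᵘP.≃-Reasoning
  d : ℤ
  d = + suc d-1
  n·d≡n·d : (n ℤ.* d) ℤ.* + 1 ≡ n ℤ.* + (suc d-1 ℕ.* 1)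
  n·d≡n·d = trans (ℤP.*-identityʳ _) (cong (λ k → n ℤ.* + suc k) (sym (ℕP.*-identityʳ d-1)))

frac-scaled : ∀ x → frac x * ι (↧ x) ≡ ι (+ rem x)
frac-scaled x = begin
  (x - ι f) * ι d                       ≡⟨ solve 3 (λ x f d → (x :- f) :* d := x :* d :- f :* d) refl x (ι f) (ι d) ⟩
  x * ι d - ι f * ι d                   ≡⟨ cong (_- ι f * ι d) (times-denominator x) ⟩
  ι (↥ x) - ι f * ι d                   ≡⟨ cong (λ m → ι m - ι f * ι d) (numerator-division x) ⟩
  ι (r ℤ.+ f ℤ.* d) - ι f * ι d         ≡⟨ cong (_- ι f * ι d) (trans (ι-+ r (f ℤ.* d)) (cong (λ m → ι r + m) (ι-* f d))) ⟩
  (ι r + ι f * ι d) - ι f * ι d         ≡⟨ solve 2 (λ r m → (r :+ m) :- m := r) refl (ι r) (ι f * ι d) ⟩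
  ι r                                   ∎
  where
  open ≡-Reasoning
  open ℚSolver.+-*-Solver
  f : ℤ
  f = floor x
  d : ℤ
  d = ↧ x
  r : ℤ
  r = + rem x

-- 0 ≤ φ < 1, read off from φ·↧x = r with 0 ≤ r < ↧x.
frac-nonneg : ∀ x → 0ℚ ≤ frac x
frac-nonneg x@(mkℚ _ d-1 _) = ℚP.*-cancelʳ-≤-pos (ι (↧ x)) {{ι-positive d-1}} (begin
  0ℚ * ι (↧ x)        ≡⟨ ℚP.*-zeroˡ (ι (↧ x)) ⟩
  ι 0ℤ                ≤⟨ ι-≤-mono {0ℤ} {+ rem x} (ℤ.+≤+ ℕ.z≤n) ⟩
  ι (+ rem x)         ≡⟨ sym (frac-scaled x) ⟩
  frac x * ι (↧ x)    ∎)
  where open ℚP.≤-Reasoning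

frac<1 : ∀ x → frac x < 1ℚ
frac<1 x@(mkℚ _ d-1 _) = ℚP.*-cancelʳ-<-nonNeg (ι (↧ x)) {{ℚP.pos⇒nonNeg (ι (↧ x)) {{ι-positive d-1}}}} (begin-strict
  frac x * ι (↧ x)    ≡⟨ frac-scaled x ⟩
  ι (+ rem x)         <⟨ ι-<-mono (ℤ.+<+ (rem<denominator x)) ⟩
  ι (↧ x)             ≡⟨ sym (ℚP.*-identityˡ (ι (↧ x))) ⟩
  1ℚ * ι (↧ x)        ∎)
  where open ℚP.≤-Reasoning

frac-decomposition : ∀ x → x ≡ ι (floor x) + frac x
frac-decomposition x = solve 2 (λ x f → x := f :+ (x :- f)) refl x (ι (floor x))
  where open ℚSolver.+-*-Solver

floor≤ : ∀ x → ι (floor x) ≤ x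
floor≤ x = subst₂ _≤_ (ℚP.+-identityʳ _) (sym (frac-decomposition x)) (ℚP.+-monoʳ-≤ (ι (floor x)) (frac-nonneg x))

<floor+1 : ∀ x → x < ι (floor x) + 1ℚ
<floor+1 x = subst (_< ι (floor x) + 1ℚ) (sym (frac-decomposition x)) (ℚP.+-monoʳ-< (ι (floor x)) (frac<1 x))

floor-unique : ∀ x z → ι z ≤ x → x < ι z + 1ℚ → floor x ≡ z
floor-unique x z z≤x x<z+1 = ℤP.≤-antisym (<-suc⇒≤ ⌊x⌋<z+1) (<-suc⇒≤ z<⌊x⌋+1)
  where
  ⌊x⌋<z+1 : floor x ℤ.< ℤ.suc z
  ⌊x⌋<z+1 = ι-<-cancel (subst (ι (floor x) <_) (sym (ι-suc z)) (ℚP.≤-<-trans (floor≤ x) x<z+1))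
  z<⌊x⌋+1 : z ℤ.< ℤ.suc (floor x)
  z<⌊x⌋+1 = ι-<-cancel (subst (ι z <_) (sym (ι-suc (floor x))) (ℚP.≤-<-trans z≤x (<floor+1 x)))

floor-ι : ∀ z → floor (ι z) ≡ z
floor-ι z = floor-unique (ι z) z ℚP.≤-refl (subst (ι z <_) (ι-suc z) (ι-<-mono (≤⇒<-suc {z} ℤP.≤-refl)))

integer⇒frac≡0 : ∀ x → IsInteger x → frac x ≡ 0ℚ
integer⇒frac≡0 _ (z , refl) = trans (cong (λ w → ι z - ι w) (floor-ι z)) (ℚP.+-inverseʳ (ι z))

frac≡0⇒integer : ∀ x → frac x ≡ 0ℚ → IsInteger x
frac≡0⇒integer x φ≡0 = floor x , trans (frac-decomposition x) (trans (cong (λ w → ι (floor x) + w) φ≡0) (ℚP.+-identityʳ _))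

isInteger? : ∀ x → Dec (IsInteger x)
isInteger? x with frac x ℚP.≟ 0ℚ
... | yes φ≡0 = yes (frac≡0⇒integer x φ≡0)
... | no φ≢0  = no (λ x∈ℤ → φ≢0 (integer⇒frac≡0 x x∈ℤ))

frac-pos : ∀ x → ¬ IsInteger x → 0ℚ < frac x
frac-pos x x∉ℤ = ≤∧≢⇒pos (frac-nonneg x) (λ φ≡0 → x∉ℤ (frac≡0⇒integer x φ≡0))

floor< : ∀ x → ¬ IsInteger x → ι (floor x) < x
floor< x x∉ℤ = subst₂ _<_ (ℚP.+-identityʳ _) (sym (frac-decomposition x)) (ℚP.+-monoʳ-< (ι (floor x)) (frac-pos x x∉ℤ))

-- For non-integral x: ⌈x⌉ = ⌊x⌋ + 1, i.e. ⌊-x⌋ = m with m = -(⌊x⌋ + 1).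
ceiling-nonint : ∀ x → ¬ IsInteger x → ceiling x ≡ ℤ.suc (floor x)
ceiling-nonint x@(mkℚ _ _ _) x∉ℤ = trans (cong ℤ.-_ ⌊-x⌋≡m) (ℤP.neg-involutive (ℤ.suc f))
  where
  open ℚSolver.+-*-Solver
  f : ℤ
  f = floor x
  ι-m : ι (ℤ.- ℤ.suc f) ≡ - (ι f + 1ℚ)
  ι-m = trans (ι-neg (ℤ.suc f)) (cong -_ (ι-suc f))
  m≤-x : ι (ℤ.- ℤ.suc f) ≤ - x
  m≤-x = subst (_≤ - x) (sym ι-m) (ℚP.neg-antimono-≤ (ℚP.<⇒≤ (<floor+1 x)))
  ι-m+1 : ι (ℤ.- ℤ.suc f) + 1ℚ ≡ - ι f
  ι-m+1 = trans (cong (_+ 1ℚ) ι-m) (solve 1 (λ a → :- (a :+ con 1ℚ) :+ con 1ℚ := :- a) refl (ι f))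
  -x<m+1 : - x < ι (ℤ.- ℤ.suc f) + 1ℚ
  -x<m+1 = subst (- x <_) (sym ι-m+1) (ℚP.neg-antimono-< (floor< x x∉ℤ))
  ⌊-x⌋≡m : floor (- x) ≡ ℤ.- ℤ.suc f
  ⌊-x⌋≡m = floor-unique (- x) _ m≤-x -x<m+1

-- If p·b = a for an integer a and a natural b > 0, then the (coprime)
-- denominator of p divides b, hence is at most b.
denominator≤ : ∀ p a {b} → 0 ℕ.< b → p * ι (+ b) ≡ ι a → ↧ₙ p ℕ.≤ b
denominator≤ p@(mkℚ n d-1 coprime) a {b@(suc _)} _ pb≡a = ∣⇒≤ (Coprimality.coprime-divisor d⊥n d∣n·b)
  where
  pb≃a : ℚᵘ.mkℚᵘ n d-1 ℚᵘ.* ℚᵘ.mkℚᵘ (+ b) 0 ℚᵘ.≃ ℚᵘ.mkℚᵘ a 0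
  pb≃a = subst₂ (λ u v → ℚᵘ.mkℚᵘ n d-1 ℚᵘ.* u ℚᵘ.≃ v) (toℚᵘ-ι (+ b)) (toℚᵘ-ι a)
           (ℚᵘP.≃-trans (ℚᵘP.≃-sym (ℚP.toℚᵘ-homo-* p (ι (+ b)))) (ℚP.toℚᵘ-cong pb≡a))
  n·b≡a·d : n ℤ.* + b ≡ a ℤ.* + suc d-1
  n·b≡a·d with pb≃a
  ... | ℚᵘ.*≡* e = trans (sym (ℤP.*-identityʳ _)) (trans e (cong (λ k → a ℤ.* + suc k) (ℕP.*-identityʳ d-1)))
  d∣n·b : suc d-1 ∣ ℤ.∣ n ∣ ℕ.* b
  d∣n·b = divides ℤ.∣ a ∣ (trans (sym (ℤP.abs-* n (+ b))) (trans (cong ℤ.∣_∣ n·b≡a·d) (ℤP.abs-* a (+ suc d-1))))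
  d⊥n : Coprimality.Coprime (suc d-1) ℤ.∣ n ∣
  d⊥n = Coprimality.sym (Coprimality.recompute coprime)

-- If q·d = k for naturals d and k > 0, then (1/q - 2)·k = d - 2k is an
-- integer, so the denominator of 1/q - 2 is at most k.
denominator-step : ∀ q .{{_ : NonZero q}} d k → 0 ℕ.< k → q * ι (+ d) ≡ ι (+ k) → ↧ₙ (1/ q - 2ℚ) ℕ.≤ k
denominator-step q d k 0<k qd≡k = denominator≤ (1/ q - 2ℚ) (+ d ℤ.- + 2 ℤ.* + k) 0<k (begin
  (1/ q - 2ℚ) * ι (+ k)                     ≡⟨ cong ((1/ q - 2ℚ) *_) (sym qd≡k) ⟩
  (1/ q - 2ℚ) * (q * D)                     ≡⟨ solve 3 (λ p q D → (p :- con 2ℚ) :* (q :* D) := (p :* q) :* D :- con 2ℚ :* (q :* D)) refl (1/ q) q D ⟩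
  (1/ q * q) * D - 2ℚ * (q * D)             ≡⟨ cong₂ (λ u v → u * D - 2ℚ * v) (ℚP.*-inverseˡ q) qd≡k ⟩
  1ℚ * D - 2ℚ * ι (+ k)                     ≡⟨ cong₂ _-_ (ℚP.*-identityˡ D) (sym (ι-* (+ 2) (+ k))) ⟩
  D - ι (+ 2 ℤ.* + k)                       ≡⟨ sym (ι-- (+ d) (+ 2 ℤ.* + k)) ⟩
  ι (+ d ℤ.- + 2 ℤ.* + k)                   ∎)
  where
  open ≡-Reasoning
  open ℚSolver.+-*-Solver
  D : ℚ
  D = ι (+ d)

cofrac-scaled : ∀ x → (1ℚ - frac x) * ι (↧ x) ≡ ι (+ (↧ₙ x ℕ.∸ rem x))
cofrac-scaled x = begin
  (1ℚ - frac x) * D           ≡⟨ solve 2 (λ φ D → (con 1ℚ :- φ) :* D := D :- φ :* D) refl (frac x) D ⟩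
  D - frac x * D              ≡⟨ cong (λ w → D - w) (frac-scaled x) ⟩
  D - ι (+ rem x)             ≡⟨ sym (ι-- (↧ x) (+ rem x)) ⟩
  ι (↧ x ℤ.- + rem x)         ≡⟨ cong ι (trans (ℤP.m-n≡m⊖n (↧ₙ x) (rem x)) (ℤP.⊖-≥ (ℕP.<⇒≤ (rem<denominator x)))) ⟩
  ι (+ (↧ₙ x ℕ.∸ rem x))      ∎
  where
  open ≡-Reasoning
  open ℚSolver.+-*-Solver
  D : ℚ
  D = ι (↧ x)

-- For non-integral x the remainder is positive, as r = φ·↧x with φ > 0;
-- so both 1/φ and 1/(1 - φ) are defined.
rem-pos : ∀ x → ¬ IsInteger x → 0 ℕ.< rem x
rem-pos x@(mkℚ _ d-1 _) x∉ℤ = ℤP.drop‿+<+ (ι-<-cancel (begin-strict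
  ι 0ℤ                 ≡⟨ sym (ℚP.*-zeroˡ (ι (↧ x))) ⟩
  0ℚ * ι (↧ x)         <⟨ ℚP.*-monoˡ-<-pos (ι (↧ x)) {{ι-positive d-1}} (frac-pos x x∉ℤ) ⟩
  frac x * ι (↧ x)     ≡⟨ frac-scaled x ⟩
  ι (+ rem x)          ∎))
  where open ℚP.≤-Reasoning

frac-nonZero : ∀ x → ¬ IsInteger x → NonZero (frac x)
frac-nonZero x x∉ℤ = ℚP.pos⇒nonZero (frac x) {{ℚ.positive (frac-pos x x∉ℤ)}}

cofrac-pos : ∀ x → 0ℚ < 1ℚ - frac x
cofrac-pos x = p<q⇒0<q-p (frac<1 x)

cofrac-nonZero : ∀ x → NonZero (1ℚ - frac x)
cofrac-nonZero x = ℚP.pos⇒nonZero (1ℚ - frac x) {{ℚ.positive (cofrac-pos x)}}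

frac-step : ∀ x (x∉ℤ : ¬ IsInteger x) → ↧ₙ ((1/ frac x) {{frac-nonZero x x∉ℤ}} - 2ℚ) ℕ.< ↧ₙ x
frac-step x x∉ℤ = ℕP.≤-<-trans
  (denominator-step (frac x) {{frac-nonZero x x∉ℤ}} (↧ₙ x) (rem x) (rem-pos x x∉ℤ) (frac-scaled x))
  (rem<denominator x)

cofrac-step : ∀ x → ¬ IsInteger x → ↧ₙ ((1/ (1ℚ - frac x)) {{cofrac-nonZero x}} - 2ℚ) ℕ.< ↧ₙ x
cofrac-step x x∉ℤ = ℕP.≤-<-trans
  (denominator-step (1ℚ - frac x) {{cofrac-nonZero x}} (↧ₙ x) (↧ₙ x ℕ.∸ rem x)
    (ℕP.m<n⇒0<n∸m (rem<denominator x)) (cofrac-scaled x))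
  (ℕP.∸-monoʳ-< (rem-pos x x∉ℤ) (ℕP.<⇒≤ (rem<denominator x)))

rep-exists : ∀ N x → ↧ₙ x ℕ.≤ N → ∃ λ l → Rep x l
rep-exists zero (mkℚ _ _ _) ()
rep-exists (suc N) x ↧x≤1+N with isInteger? x | frac x ℚP.<? ½
... | yes (z , refl) | _ = z ∷ [] , rep-int z
... | no x∉ℤ | yes φ<½ =
  let (l , rep) = rep-exists N _ (ℕP.≤-pred (ℕP.<-≤-trans (frac-step x x∉ℤ) ↧x≤1+N))
  in ceiling x ∷ map ℤ.-_ l , rep-lt x l x∉ℤ (frac-nonZero x x∉ℤ) φ<½ rep
... | no x∉ℤ | no φ≮½ =
  let (l , rep) = rep-exists N _ (ℕP.≤-pred (ℕP.<-≤-trans (cofrac-step x x∉ℤ) ↧x≤1+N))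
  in ceiling x ∷ l , rep-ge x l x∉ℤ (cofrac-nonZero x) φ≮½ rep

-- The next argument of the recursion is positive in the branch φ < ½
-- (as 1/φ > 1/½ = 2) and nonnegative in the branch φ ≥ ½ (as 1 - φ ≤ ½).
next-pos : ∀ x (nz : NonZero (frac x)) → ¬ IsInteger x → frac x < ½ → 0ℚ < (1/ frac x) {{nz}} - 2ℚ
next-pos x nz x∉ℤ φ<½ = p<q⇒0<q-p (1/-antimono-< (frac x) ½ {{ℚ.positive (frac-pos x x∉ℤ)}} φ<½)

next-nonneg : ∀ x (nz : NonZero (1ℚ - frac x)) → ¬ (frac x < ½) → 0ℚ ≤ (1/ (1ℚ - frac x)) {{nz}} - 2ℚ
next-nonneg x nz φ≮½ = p≤q⇒0≤q-p (1/-antimono-≤ (1ℚ - frac x) ½ {{ℚ.positive (cofrac-pos x)}} 1-φ≤½)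
  where
  1-φ≤½ : 1ℚ - frac x ≤ ½
  1-φ≤½ = ℚP.+-monoʳ-≤ 1ℚ (ℚP.neg-antimono-≤ (ℚP.≮⇒≥ φ≮½))

ceiling-pos : ∀ y → ¬ IsInteger y → 0ℚ < y → 0ℤ ℤ.< ceiling y
ceiling-pos y y∉ℤ 0<y = subst (0ℤ ℤ.<_) (sym (ceiling-nonint y y∉ℤ)) (≤⇒<-suc 0≤⌊y⌋)
  where
  0≤⌊y⌋ : 0ℤ ℤ.≤ floor y
  0≤⌊y⌋ = <-suc⇒≤ (ι-<-cancel (subst (0ℚ <_) (sym (ι-suc (floor y))) (ℚP.<-trans 0<y (<floor+1 y))))

ceiling-pos⇒pos : ∀ y → ¬ IsInteger y → 0ℤ ℤ.< ceiling y → 0ℚ < y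
ceiling-pos⇒pos y y∉ℤ 0<⌈y⌉ = ℚP.≤-<-trans (ι-≤-mono 0≤⌊y⌋) (floor< y y∉ℤ)
  where
  0≤⌊y⌋ : 0ℤ ℤ.≤ floor y
  0≤⌊y⌋ = <-suc⇒≤ (subst (0ℤ ℤ.<_) (ceiling-nonint y y∉ℤ) 0<⌈y⌉)

nonint-nonneg⇒pos : ∀ y → ¬ IsInteger y → 0ℚ ≤ y → 0ℚ < y
nonint-nonneg⇒pos y y∉ℤ 0≤y = ≤∧≢⇒pos 0≤y (λ y≡0 → y∉ℤ (0ℤ , y≡0))

rep-nonempty : ∀ {y l} → Rep y l → l ≢ []
rep-nonempty (rep-int _) ()
rep-nonempty (rep-lt _ _ _ _ _ _) ()
rep-nonempty (rep-ge _ _ _ _ _ _) ()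

rep-head : ∀ {y h t} → Rep y (h ∷ t) → (y ≡ ι h × t ≡ []) ⊎ (¬ IsInteger y × h ≡ ceiling y × t ≢ [])
rep-head (rep-int _) = inj₁ (refl , refl)
rep-head (rep-lt _ _ y∉ℤ _ _ rep) = inj₂ (y∉ℤ , refl , λ ml≡[] → rep-nonempty rep (map-empty ml≡[]))
  where
  map-empty : ∀ {l : List ℤ} → map ℤ.-_ l ≡ [] → l ≡ []
  map-empty {[]} _ = refl
rep-head (rep-ge _ _ y∉ℤ _ _ rep) = inj₂ (y∉ℤ , refl , rep-nonempty rep)

pos⇒head-pos : ∀ {y h t} → Rep y (h ∷ t) → 0ℚ < y → 0ℤ ℤ.< h
pos⇒head-pos rep 0<y with rep-head rep
... | inj₁ (refl , _) = ι-<-cancel 0<y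
... | inj₂ (y∉ℤ , refl , _) = ceiling-pos _ y∉ℤ 0<y

nonneg⇒head-nonneg : ∀ {y h t} → Rep y (h ∷ t) → 0ℚ ≤ y → 0ℤ ℤ.≤ h
nonneg⇒head-nonneg rep 0≤y with rep-head rep
... | inj₁ (refl , _) = ι-≤-cancel 0≤y
... | inj₂ (y∉ℤ , refl , _) = ℤP.<⇒≤ (ceiling-pos _ y∉ℤ (nonint-nonneg⇒pos _ y∉ℤ 0≤y))

nonneg⇒head-nonzero : ∀ {y h b t} → Rep y (h ∷ b ∷ t) → 0ℚ ≤ y → h ≢ 0ℤ
nonneg⇒head-nonzero rep 0≤y with rep-head rep
... | inj₂ (y∉ℤ , refl , _) = λ h≡0 → ℤP.<⇒≢ (ceiling-pos _ y∉ℤ (nonint-nonneg⇒pos _ y∉ℤ 0≤y)) (sym h≡0)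

head-pos⇒pos : ∀ {y h t} → Rep y (h ∷ t) → 0ℤ ℤ.< h → 0ℚ < y
head-pos⇒pos rep 0<h with rep-head rep
... | inj₁ (refl , _) = ι-<-mono 0<h
... | inj₂ (y∉ℤ , refl , _) = ceiling-pos⇒pos _ y∉ℤ 0<h

head-nonneg⇒nonneg : ∀ {y h t} → Rep y (h ∷ t) → 0ℤ ℤ.≤ h → (t ≢ [] → h ≢ 0ℤ) → 0ℚ ≤ y
head-nonneg⇒nonneg rep 0≤h h≢0 with rep-head rep
... | inj₁ (refl , _) = ι-≤-mono 0≤h
... | inj₂ (y∉ℤ , refl , t≢[]) = ℚP.<⇒≤ (ceiling-pos⇒pos _ y∉ℤ (ℤP.≤∧≢⇒< 0≤h (λ 0≡h → h≢0 t≢[] (sym 0≡h))))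

-- The set 𝒮 recursively: a head followed by a list all of whose entries
-- except the last are nonzero.
NonzeroButLast : List ℤ → Set
NonzeroButLast []          = ⊤
NonzeroButLast (_ ∷ [])    = ⊤
NonzeroButLast (a ∷ b ∷ t) = a ≢ 0ℤ × NonzeroButLast (b ∷ t)

Admissible : List ℤ → Set
Admissible []      = ⊥
Admissible (_ ∷ t) = NonzeroButLast t

nonzeroButLast-tail : ∀ {a t} → NonzeroButLast (a ∷ t) → NonzeroButLast t
nonzeroButLast-tail {t = []}    _       = tt
nonzeroButLast-tail {t = _ ∷ _} (_ , m) = m

nonzeroButLast-head : ∀ {a t} → NonzeroButLast (a ∷ t) → t ≢ [] → a ≢ 0ℤ
nonzeroButLast-head {t = []}    _        t≢[] = ⊥-elim (t≢[] refl)
nonzeroButLast-head {t = _ ∷ _} (a≢0 , _) _   = a≢0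

nonzeroButLast-neg : ∀ t → NonzeroButLast t → NonzeroButLast (map ℤ.-_ t)
nonzeroButLast-neg []          _         = tt
nonzeroButLast-neg (_ ∷ [])    _         = tt
nonzeroButLast-neg (a ∷ b ∷ t) (a≢0 , m) =
  (λ -a≡0 → a≢0 (trans (sym (ℤP.neg-involutive a)) (cong ℤ.-_ -a≡0))) , nonzeroButLast-neg (b ∷ t) m

map-neg-involutive : ∀ l → map ℤ.-_ (map ℤ.-_ l) ≡ l
map-neg-involutive []      = refl
map-neg-involutive (a ∷ l) = cong₂ _∷_ (ℤP.neg-involutive a) (map-neg-involutive l)

length-map-neg : ∀ l → length (map ℤ.-_ l) ≡ length l
length-map-neg []      = refl
length-map-neg (_ ∷ l) = cong suc (length-map-neg l)

nonzeroButLast⇒lookup : ∀ t → NonzeroButLast t →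
  (j : Fin (length t)) → suc (toℕ j) ℕ.< length t → lookup t j ≢ 0ℤ
nonzeroButLast⇒lookup (_ ∷ [])    _         fzero    (ℕ.s≤s ())
nonzeroButLast⇒lookup (_ ∷ _ ∷ _) (a≢0 , _) fzero    _ = a≢0
nonzeroButLast⇒lookup (_ ∷ b ∷ t) (_ , m)   (fsuc j) j+1<n = nonzeroButLast⇒lookup (b ∷ t) m j (ℕP.≤-pred j+1<n)

lookup⇒nonzeroButLast : ∀ t →
  ((j : Fin (length t)) → suc (toℕ j) ℕ.< length t → lookup t j ≢ 0ℤ) → NonzeroButLast t
lookup⇒nonzeroButLast []          _ = tt
lookup⇒nonzeroButLast (_ ∷ [])    _ = tt
lookup⇒nonzeroButLast (a ∷ b ∷ t) f =
  f fzero (ℕ.s≤s (ℕ.s≤s ℕ.z≤n)) , lookup⇒nonzeroButLast (b ∷ t) (λ j j+1<n → f (fsuc j) (ℕ.s≤s j+1<n))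

admissible⇒InS : ∀ l → Admissible l → InS l
admissible⇒InS (_ ∷ t) m = ℕ.s≤s ℕ.z≤n , nonzero
  where
  nonzero : (i : Fin (suc (length t))) → 1 ℕ.≤ toℕ i → suc (toℕ i) ℕ.< suc (length t) → lookup (_ ∷ t) i ≢ 0ℤ
  nonzero (fsuc j) _ j+2<n = nonzeroButLast⇒lookup t m j (ℕP.≤-pred j+2<n)

InS⇒admissible : ∀ l → InS l → Admissible l
InS⇒admissible (_ ∷ t) (_ , f) = lookup⇒nonzeroButLast t (λ j j+1<n → f (fsuc j) (ℕ.s≤s ℕ.z≤n) (ℕ.s≤s j+1<n))

-- s(x) ∈ 𝒮: the tail is s(y) or its negation for a y ≥ 0, whose head is
-- nonzero unless it is the last entry.
nonneg-rep⇒nonzeroButLast : ∀ {y l} → Rep y l → 0ℚ ≤ y → Admissible l → NonzeroButLast l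
nonneg-rep⇒nonzeroButLast {l = _ ∷ []}    _   _   _ = tt
nonneg-rep⇒nonzeroButLast {l = _ ∷ _ ∷ _} rep 0≤y m = nonneg⇒head-nonzero rep 0≤y , m

rep-admissible : ∀ {x l} → Rep x l → Admissible l
rep-admissible (rep-int _) = tt
rep-admissible (rep-lt x l x∉ℤ nz φ<½ rep) =
  nonzeroButLast-neg l (nonneg-rep⇒nonzeroButLast rep (ℚP.<⇒≤ (next-pos x nz x∉ℤ φ<½)) (rep-admissible rep))
rep-admissible (rep-ge x l _ nz φ≮½ rep) =
  nonneg-rep⇒nonzeroButLast rep (next-nonneg x nz φ≮½) (rep-admissible rep)

-- s(x) is uniquely determined: the clauses of the recursion are mutually
-- exclusive.  (Stated for equal arguments x ≡ x′ so that the cases split.)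
rep-unique : ∀ {x x′ l l′} → Rep x l → Rep x′ l′ → x ≡ x′ → l ≡ l′
rep-unique (rep-int _) (rep-int _) x≡x′ = cong (_∷ []) (ι-injective x≡x′)
rep-unique (rep-int z) (rep-lt _ _ x∉ℤ _ _ _) x≡x′ = ⊥-elim (x∉ℤ (z , sym x≡x′))
rep-unique (rep-int z) (rep-ge _ _ x∉ℤ _ _ _) x≡x′ = ⊥-elim (x∉ℤ (z , sym x≡x′))
rep-unique (rep-lt _ _ x∉ℤ _ _ _) (rep-int z) x≡x′ = ⊥-elim (x∉ℤ (z , x≡x′))
rep-unique (rep-ge _ _ x∉ℤ _ _ _) (rep-int z) x≡x′ = ⊥-elim (x∉ℤ (z , x≡x′))
rep-unique (rep-lt x _ _ _ _ rep) (rep-lt _ _ _ _ _ rep′) refl = cong (λ l → ceiling x ∷ map ℤ.-_ l) (rep-unique rep rep′ refl)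
rep-unique (rep-ge x _ _ _ _ rep) (rep-ge _ _ _ _ _ rep′) refl = cong (ceiling x ∷_) (rep-unique rep rep′ refl)
rep-unique (rep-lt _ _ _ _ φ<½ _) (rep-ge _ _ _ _ φ≮½ _) refl = ⊥-elim (φ≮½ φ<½)
rep-unique (rep-ge _ _ _ _ φ≮½ _) (rep-lt _ _ _ _ φ<½ _) refl = ⊥-elim (φ≮½ φ<½)

-- F is a function: the sign of s₁ selects exactly one clause.
F-unique : ∀ {l v w} → FRel l v → FRel l w → v ≡ w
F-unique (F-one _) (F-one _) = refl
F-unique (F-pos _ _ _ _ _ F _) (F-pos _ _ _ _ _ F′ _) with F-unique F F′
... | refl = refl
F-unique (F-neg _ _ _ _ _ F _) (F-neg _ _ _ _ _ F′ _) with F-unique F F′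
... | refl = refl
F-unique (F-pos _ _ _ _ 0≤s₁ _ _) (F-neg _ _ _ _ s₁<0 _ _) = ⊥-elim (ℤP.<-irrefl refl (ℤP.≤-<-trans 0≤s₁ s₁<0))
F-unique (F-neg _ _ _ _ s₁<0 _ _) (F-pos _ _ _ _ 0≤s₁ _ _) = ⊥-elim (ℤP.<-irrefl refl (ℤP.≤-<-trans 0≤s₁ s₁<0))

-- The reciprocal respects equality whatever the (irrelevant) NonZero proofs.
1/-cong : ∀ {p q} .{{_ : NonZero p}} .{{_ : NonZero q}} → p ≡ q → 1/ p ≡ 1/ q
1/-cong refl = refl

2+[a-2]≡a : ∀ a → 2ℚ + (a - 2ℚ) ≡ a
2+[a-2]≡a a = solve 2 (λ a t → t :+ (a :- t) := a) refl a 2ℚ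
  where open ℚSolver.+-*-Solver

-- F forms 1/(2 + y) where s passed to y = 1/q - 2; this recovers q.
step-nonZero : ∀ q .{{_ : NonZero q}} → NonZero (2ℚ + (1/ q - 2ℚ))
step-nonZero q = subst NonZero (sym (2+[a-2]≡a (1/ q))) (ℚP.nonZero⇒1/nonZero q)

reciprocal-step : ∀ q .{{_ : NonZero q}} → (1/ (2ℚ + (1/ q - 2ℚ))) {{step-nonZero q}} ≡ q
reciprocal-step q = trans (1/-cong {{step-nonZero q}} {{ℚP.nonZero⇒1/nonZero q}} (2+[a-2]≡a (1/ q))) (ℚP.1/-involutive q)

ι-ceiling : ∀ x → ¬ IsInteger x → ι (ceiling x) ≡ ι (floor x) + 1ℚ
ι-ceiling x x∉ℤ = trans (cong ι (ceiling-nonint x x∉ℤ)) (ι-suc (floor x))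

-- In the branch φ < ½ the next argument is positive, so s₁ < 0
-- and F uses its third clause: (⌈x⌉ - 1) + φ = x; in the branch φ ≥ ½ it is
-- nonnegative, so s₁ ≥ 0 and F uses its second clause: ⌈x⌉ - (1 - φ) = x.
rep⇒F : ∀ {x l} → Rep x l → FRel l x
rep⇒F (rep-int z) = F-one z
rep⇒F (rep-lt x (h ∷ t) x∉ℤ nz φ<½ rep) =
  subst (FRel _) value (F-neg (ceiling x) (ℤ.- h) (map ℤ.-_ t) y -h<0 F-y (step-nonZero (frac x) {{nz}}))
  where
  open ≡-Reasoning
  open ℚSolver.+-*-Solver
  y : ℚ
  y = (1/ frac x) {{nz}} - 2ℚ
  -h<0 : ℤ.- h ℤ.< 0ℤ
  -h<0 = ℤP.neg-mono-< (pos⇒head-pos rep (next-pos x nz x∉ℤ φ<½))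
  F-y : FRel (map ℤ.-_ (ℤ.- h ∷ map ℤ.-_ t)) y
  F-y = subst (λ l → FRel l y) (sym (map-neg-involutive (h ∷ t))) (rep⇒F rep)
  value : (ι (ceiling x) - 1ℚ) + (1/ (2ℚ + y)) {{step-nonZero (frac x) {{nz}}}} ≡ x
  value = begin
    (ι (ceiling x) - 1ℚ) + (1/ (2ℚ + y)) {{_}}  ≡⟨ cong₂ (λ c u → (c - 1ℚ) + u) (ι-ceiling x x∉ℤ) (reciprocal-step (frac x) {{nz}}) ⟩
    (ι (floor x) + 1ℚ - 1ℚ) + frac x             ≡⟨ solve 2 (λ f φ → (f :+ con 1ℚ :- con 1ℚ) :+ φ := f :+ φ) refl (ι (floor x)) (frac x) ⟩
    ι (floor x) + frac x                         ≡⟨ sym (frac-decomposition x) ⟩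
    x                                            ∎
rep⇒F (rep-ge x (h ∷ t) x∉ℤ nz φ≮½ rep) =
  subst (FRel _) value (F-pos (ceiling x) h t y 0≤h (rep⇒F rep) (step-nonZero (1ℚ - frac x) {{nz}}))
  where
  open ≡-Reasoning
  open ℚSolver.+-*-Solver
  y : ℚ
  y = (1/ (1ℚ - frac x)) {{nz}} - 2ℚ
  0≤h : 0ℤ ℤ.≤ h
  0≤h = nonneg⇒head-nonneg rep (next-nonneg x nz φ≮½)
  value : ι (ceiling x) - (1/ (2ℚ + y)) {{step-nonZero (1ℚ - frac x) {{nz}}}} ≡ x
  value = begin
    ι (ceiling x) - (1/ (2ℚ + y)) {{_}}          ≡⟨ cong₂ _-_ (ι-ceiling x x∉ℤ) (reciprocal-step (1ℚ - frac x) {{nz}}) ⟩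
    (ι (floor x) + 1ℚ) - (1ℚ - frac x)           ≡⟨ solve 2 (λ f φ → (f :+ con 1ℚ) :- (con 1ℚ :- φ) := f :+ φ) refl (ι (floor x)) (frac x) ⟩
    ι (floor x) + frac x                         ≡⟨ sym (frac-decomposition x) ⟩
    x                                            ∎

module _ (g : ℤ) {u : ℚ} (0<u : 0ℚ < u) (u<1 : u < 1ℚ) where
  floor-shift : floor (ι g + u) ≡ g
  floor-shift = floor-unique (ι g + u) g g≤g+u (ℚP.+-monoʳ-< (ι g) u<1)
    where
    g≤g+u : ι g ≤ ι g + u
    g≤g+u = subst (_≤ ι g + u) (ℚP.+-identityʳ (ι g)) (ℚP.+-monoʳ-≤ (ι g) (ℚP.<⇒≤ 0<u))

  frac-shift : frac (ι g + u) ≡ u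
  frac-shift = trans (cong (λ f → (ι g + u) - ι f) floor-shift) (solve 2 (λ g u → (g :+ u) :- g := u) refl (ι g) u)
    where open ℚSolver.+-*-Solver

  shift-nonint : ¬ IsInteger (ι g + u)
  shift-nonint x∈ℤ = ℚP.<⇒≢ 0<u (trans (sym (integer⇒frac≡0 _ x∈ℤ)) frac-shift)

  ceiling-shift : ceiling (ι g + u) ≡ ℤ.suc g
  ceiling-shift = trans (ceiling-nonint _ shift-nonint) (cong ℤ.suc floor-shift)

-- For y ≥ 0 the number u = 1/(2 + y) lies in (0, ½], and 1/u - 2 = y:
-- u is the value of φ (or 1 - φ) from which the recursion produces y.
module Reverse (y : ℚ) (0≤y : 0ℚ ≤ y) where
  w : ℚ
  w = 2ℚ + y

  2≤w : 2ℚ ≤ w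
  2≤w = subst (_≤ w) (ℚP.+-identityʳ 2ℚ) (ℚP.+-monoʳ-≤ 2ℚ 0≤y)

  instance
    w>0 : Positive w
    w>0 = ℚ.positive (ℚP.<-≤-trans (ι-<-mono {0ℤ} {+ 2} (ℤ.+<+ (ℕ.s≤s ℕ.z≤n))) 2≤w)
    w≢0 : NonZero w
    w≢0 = ℚP.pos⇒nonZero w

  u : ℚ
  u = 1/ w

  0<u : 0ℚ < u
  0<u = ℚP.positive⁻¹ u {{ℚP.1/pos⇒pos w}}

  u≤½ : u ≤ ½
  u≤½ = 1/-antimono-≤ 2ℚ w 2≤w

  u<½ : 0ℚ < y → u < ½
  u<½ 0<y = 1/-antimono-< 2ℚ w (subst (_< w) (ℚP.+-identityʳ 2ℚ) (ℚP.+-monoʳ-< 2ℚ 0<y))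

  u-nonZero : NonZero u
  u-nonZero = ℚP.nonZero⇒1/nonZero w

  undo : ∀ q .{{_ : NonZero q}} → q ≡ u → 1/ q - 2ℚ ≡ y
  undo q q≡u = begin
    1/ q - 2ℚ             ≡⟨ cong (_- 2ℚ) (trans (1/-cong {{_}} {{u-nonZero}} q≡u) (ℚP.1/-involutive w)) ⟩
    (2ℚ + y) - 2ℚ         ≡⟨ solve 1 (λ y → (con 2ℚ :+ y) :- con 2ℚ := y) refl y ⟩
    y                     ∎
    where
    open ≡-Reasoning
    open ℚSolver.+-*-Solver

½<1 : ½ < 1ℚ
½<1 = ℚ.*<* (ℤ.+<+ (ℕ.s≤s (ℕ.s≤s ℕ.z≤n)))

prepend-lt : ∀ h {y l} → Rep y l → 0ℚ < y → ∃ λ x → Rep x (h ∷ map ℤ.-_ l)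
prepend-lt h {y} {l} rep 0<y =
  x , subst (λ c → Rep x (c ∷ map ℤ.-_ l)) ⌈x⌉≡h (rep-lt x l (shift-nonint g 0<u u<1) φ≢0 φ<½ rep′)
  where
  open Reverse y (ℚP.<⇒≤ 0<y)
  g : ℤ
  g = ℤ.pred h
  u<1 : u < 1ℚ
  u<1 = ℚP.<-trans (u<½ 0<y) ½<1
  x : ℚ
  x = ι g + u
  φ≡u : frac x ≡ u
  φ≡u = frac-shift g 0<u u<1
  φ≢0 : NonZero (frac x)
  φ≢0 = subst NonZero (sym φ≡u) u-nonZero
  φ<½ : frac x < ½
  φ<½ = subst (_< ½) (sym φ≡u) (u<½ 0<y)
  ⌈x⌉≡h : ceiling x ≡ h
  ⌈x⌉≡h = trans (ceiling-shift g 0<u u<1) (ℤP.suc-pred h)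
  rep′ : Rep ((1/ frac x) {{φ≢0}} - 2ℚ) l
  rep′ = subst (λ z → Rep z l) (sym (undo (frac x) {{φ≢0}} φ≡u)) rep

prepend-ge : ∀ h {y l} → Rep y l → 0ℚ ≤ y → ∃ λ x → Rep x (h ∷ l)
prepend-ge h {y} {l} rep 0≤y =
  x , subst (λ c → Rep x (c ∷ l)) ⌈x⌉≡h (rep-ge x l (shift-nonint g 0<v v<1) 1-φ≢0 φ≮½ rep′)
  where
  open Reverse y 0≤y
  g : ℤ
  g = ℤ.pred h
  v : ℚ
  v = 1ℚ - u
  0<v : 0ℚ < v
  0<v = p<q⇒0<q-p (ℚP.≤-<-trans u≤½ ½<1)
  v<1 : v < 1ℚ
  v<1 = subst (v <_) (ℚP.+-identityʳ 1ℚ) (ℚP.+-monoʳ-< 1ℚ (ℚP.neg-antimono-< 0<u))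
  x : ℚ
  x = ι g + v
  φ≡v : frac x ≡ v
  φ≡v = frac-shift g 0<v v<1
  1-φ≡u : 1ℚ - frac x ≡ u
  1-φ≡u = trans (cong (λ φ → 1ℚ - φ) φ≡v) (solve 1 (λ u → con 1ℚ :- (con 1ℚ :- u) := u) refl u)
    where open ℚSolver.+-*-Solver
  1-φ≢0 : NonZero (1ℚ - frac x)
  1-φ≢0 = subst NonZero (sym 1-φ≡u) u-nonZero
  φ≮½ : ¬ (frac x < ½)
  φ≮½ φ<½ = ℚP.<-irrefl refl (ℚP.<-≤-trans (subst (_< ½) φ≡v φ<½) ½≤v)
    where
    ½≤v : ½ ≤ v
    ½≤v = ℚP.+-monoʳ-≤ 1ℚ (ℚP.neg-antimono-≤ u≤½)
  ⌈x⌉≡h : ceiling x ≡ h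
  ⌈x⌉≡h = trans (ceiling-shift g 0<v v<1) (ℤP.suc-pred h)
  rep′ : Rep ((1/ (1ℚ - frac x)) {{1-φ≢0}} - 2ℚ) l
  rep′ = subst (λ z → Rep z l) (sym (undo (1ℚ - frac x) {{1-φ≢0}} 1-φ≡u)) rep

-- Every admissible list h ∷ t is some s(x), by induction on the length of t:
-- t, negated if its head is negative, is some s(y) with y > 0 resp. y ≥ 0,
-- and prepend-lt resp. prepend-ge put h in front.
admissible⇒rep : ∀ n h t → length t ≡ n → NonzeroButLast t → ∃ λ x → Rep x (h ∷ t)
admissible⇒rep _ h [] _ _ = ι h , rep-int h
admissible⇒rep (suc n) h (s ∷ t) len m with s ℤP.<? 0ℤ
... | yes s<0 =
  let (_ , rep) = admissible⇒rep n (ℤ.- s) (map ℤ.-_ t) (trans (length-map-neg t) (ℕP.suc-injective len))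
                    (nonzeroButLast-neg t (nonzeroButLast-tail m))
  in subst (λ l → ∃ λ x → Rep x (h ∷ l)) (map-neg-involutive (s ∷ t))
       (prepend-lt h rep (head-pos⇒pos rep (ℤP.neg-mono-< s<0)))
... | no s≮0 =
  let (_ , rep) = admissible⇒rep n s t (ℕP.suc-injective len) (nonzeroButLast-tail m)
  in prepend-ge h rep (head-nonneg⇒nonneg rep (ℤP.≮⇒≥ s≮0) (nonzeroButLast-head m))

InS⇒rep : ∀ l → InS l → ∃ λ x → Rep x l
InS⇒rep (h ∷ t) l∈𝒮 = admissible⇒rep (length t) h t refl (InS⇒admissible (h ∷ t) l∈𝒮)

mainTheorem2 :
    ((x : ℚ) → ∃ λ (l : List ℤ) → Rep x l) ×
    ((x : ℚ) (l l′ : List ℤ) → Rep x l → Rep x l′ → l ≡ l′) ×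
    ((x : ℚ) (l : List ℤ) → Rep x l → InS l) ×
    ((x y : ℚ) (l : List ℤ) → Rep x l → Rep y l → x ≡ y) ×
    ((l : List ℤ) → InS l → ∃ λ (x : ℚ) → Rep x l) ×
    ((l : List ℤ) → InS l → ∃ λ (v : ℚ) → FRel l v) ×
    ((l : List ℤ) (v w : ℚ) → FRel l v → FRel l w → v ≡ w) ×
    ((x : ℚ) (l : List ℤ) → Rep x l → FRel l x)
mainTheorem2 =
    (λ x → rep-exists (↧ₙ x) x ℕP.≤-refl)
  , (λ _ _ _ rep rep′ → rep-unique rep rep′ refl)
  , (λ _ l rep → admissible⇒InS l (rep-admissible rep))
  , (λ _ _ _ rep rep′ → F-unique (rep⇒F rep) (rep⇒F rep′))
  , InS⇒rep
  , (λ l l∈𝒮 → let (x , rep) = InS⇒rep l l∈𝒮 in x , rep⇒F rep)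
  , (λ _ _ _ → F-unique)
  , (λ _ _ → rep⇒F)
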